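{- Let $w\ge 2$ be an Erdős–Woods number. Then $w$ is prime partitionable (both notions as defined in the context below).
   Context: A positive integer $w$ is an Erdős–Woods number if there exist positive integers $e_1<e_2$ with $w=e_2-e_1$ such that every integer $k$ with $e_1\le k\le e_2$ satisfies $\gcd(k,e_1)>1$ or $\gcd(k,e_2)>1$. An integer $n$ is called prime partitionable if there is a partition $\{\mathbb{P}_1,\mathbb{P}_2\}$ of the set of all primes less than $n$ into two nonempty disjoint sets such that for all positive integers $n_1,n_2$ with $n_1+n_2=n$ there is some pair $(p_1,p_2)\in\mathbb{P}_1\times\mathbb{P}_2$ with $\gcd(n_1,p_1)>1$ or $\gcd(n_2,p_2)>1$. -}

module Defs where

open import Data.Nat using (ℕ; _+_; _≤_; _<_)
open import Data.Nat.GCD using (gcd)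
open import Data.Nat.Primality using (Prime)
open import Data.Bool using (Bool; true; false)
open import Data.Product using (Σ; ∃; _×_)
open import Data.Sum using (_⊎_)
open import Relation.Binary.PropositionalEquality using (_≡_)

ErdosWoods : ℕ → Set
ErdosWoods w =
  0 < w × ∃ λ e₁ → ∃ λ e₂ →
    0 < e₁ × e₁ < e₂ × e₂ ≡ e₁ + w ×
    (∀ k → e₁ ≤ k → k ≤ e₂ → 1 < gcd k e₁ ⊎ 1 < gcd k e₂)

-- A partition {ℙ₁, ℙ₂} of the primes less than n is given by a colouring
-- c : ℕ → Bool; ℙ₁ = {p prime, p < n, c p ≡ true}, ℙ₂ = {p prime, p < n, c p ≡ false}.
-- These are automatically disjoint and cover all primes < n.
InPart : ℕ → (ℕ → Bool) → Bool → ℕ → Set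
InPart n c b p = Prime p × p < n × c p ≡ b

PrimePartitionable : ℕ → Set
PrimePartitionable n =
  ∃ λ (c : ℕ → Bool) →
    (∃ λ p → InPart n c true p) ×
    (∃ λ p → InPart n c false p) ×
    (∀ n₁ n₂ → 0 < n₁ → 0 < n₂ → n₁ + n₂ ≡ n →
       ∃ λ p₁ → ∃ λ p₂ → InPart n c true p₁ × InPart n c false p₂ ×
         (1 < gcd n₁ p₁ ⊎ 1 < gcd n₂ p₂))

module Submission where

-- Let [e₁, e₂] be an Erdős–Woods interval of length w = e₂ - e₁.
-- Colour a prime "true" if it divides e₁ and "false" otherwise.  For a split
-- w = n₁ + n₂ consider k = e₁ + n₁, which lies in [e₁, e₂].
--   * If gcd(k, e₁) > 1, a common prime p divides e₁ and k - e₁ = n₁.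
--   * If gcd(k, e₂) > 1, a common prime q divides e₂ - k = n₂; if moreover
--     q ∣ e₁ then q ∣ n₁ as well, so we are back in the first case.
-- Hence every split is "covered": a true prime divides n₁ or a false prime
-- divides n₂ (lemma erdosWoods⇒covered).  Since such a prime divides a number
-- below w, it is below w.  Both colour classes are nonempty: the splits 1 + v
-- and v + 1 (where w = v + 1, v ≥ 1) can only be covered by a false, resp.
-- true, prime, because no prime divides 1 (lemma covered⇒partitionable).

open import Defs
open import Data.Nat.Base
open import Data.Nat.Properties
open import Data.Nat.Divisibility
open import Data.Nat.GCD using (gcd; gcd[m,n]∣m; gcd[m,n]∣n; gcd-greatest)
open import Data.Nat.Primality using (Prime; prime⇒nonTrivial)
open import Data.Nat.Primality.Factorisation using (factorise)
open import Data.Nat.ListAction using (product)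
open import Data.List.Base using ([]; _∷_)
open import Data.List.Relation.Unary.All using (_∷_)
open import Data.Bool using (Bool; true; false)
open import Data.Product using (∃; _×_; _,_; proj₁; proj₂)
open import Data.Sum using (_⊎_; inj₁; inj₂)
open import Data.Empty using (⊥-elim)
open import Relation.Nullary using (¬_; does; yes; no)
open import Relation.Nullary.Decidable using (dec-true; dec-false)
open import Relation.Binary.PropositionalEquality

prime>1 : ∀ {p} → Prime p → 1 < p
prime>1 pp = nonTrivial⇒n>1 _ {{prime⇒nonTrivial pp}}

prime∤1 : ∀ {p} → Prime p → ¬ (p ∣ 1)
prime∤1 pp p∣1 = <-irrefl (sym (∣1⇒≡1 p∣1)) (prime>1 pp)

primeDivisor : ∀ n → 1 < n → ∃ λ p → Prime p × p ∣ n
primeDivisor n 1<n with factorise n {{>-nonZero (<-trans z<s 1<n)}}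
... | record { factors = [] ; isFactorisation = eq } = ⊥-elim (<-irrefl (sym eq) 1<n)
... | record { factors = p ∷ ps ; isFactorisation = eq ; factorsPrime = pp ∷ _ } =
  p , pp , subst (p ∣_) (sym eq) (m∣m*n (product ps))

commonPrime : ∀ a b → 1 < gcd a b → ∃ λ p → Prime p × p ∣ a × p ∣ b
commonPrime a b g with primeDivisor (gcd a b) g
... | p , pp , p∣g = p , pp , ∣-trans p∣g (gcd[m,n]∣m a b) , ∣-trans p∣g (gcd[m,n]∣n a b)

prime∣⇒gcd>1 : ∀ {p n} → Prime p → p ∣ n → 1 < gcd n p
prime∣⇒gcd>1 {p} {n} pp p∣n = subst (1 <_) (sym gcd≡p) (prime>1 pp)
  where
  gcd≡p : gcd n p ≡ p
  gcd≡p = ∣-antisym (gcd[m,n]∣n n p) (gcd-greatest p∣n ∣-refl)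

∣⇒<-bound : ∀ {p n w} → p ∣ n → 0 < n → n < w → p < w
∣⇒<-bound {n = suc _} p∣n _ n<w = ≤-<-trans (∣⇒≤ p∣n) n<w

colour : ℕ → ℕ → Bool
colour e p = does (p ∣? e)

Covered : ℕ → ℕ → ℕ → Set
Covered e n₁ n₂ =
  (∃ λ p → Prime p × p ∣ e × p ∣ n₁) ⊎ (∃ λ q → Prime q × ¬ (q ∣ e) × q ∣ n₂)

sharedFactor⇒covered : ∀ e n₁ n₂ →
  1 < gcd (e + n₁) e ⊎ 1 < gcd (e + n₁) (e + n₁ + n₂) → Covered e n₁ n₂
sharedFactor⇒covered e n₁ n₂ (inj₁ g) with commonPrime (e + n₁) e g
... | p , pp , p∣k , p∣e = inj₁ (p , pp , p∣e , ∣m+n∣m⇒∣n p∣k p∣e)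
sharedFactor⇒covered e n₁ n₂ (inj₂ g) with commonPrime (e + n₁) (e + n₁ + n₂) g
... | q , qp , q∣k , q∣e₂ with q ∣? e
...   | yes q∣e = inj₁ (q , qp , q∣e , ∣m+n∣m⇒∣n q∣k q∣e)
...   | no  q∤e = inj₂ (q , qp , q∤e , ∣m+n∣m⇒∣n q∣e₂ q∣k)

erdosWoods⇒covered : ∀ {w} e₁ →
  (∀ k → e₁ ≤ k → k ≤ e₁ + w → 1 < gcd k e₁ ⊎ 1 < gcd k (e₁ + w)) →
  ∀ n₁ n₂ → n₁ + n₂ ≡ w → Covered e₁ n₁ n₂
erdosWoods⇒covered e₁ H n₁ n₂ refl =
  sharedFactor⇒covered e₁ n₁ n₂
    (subst (λ e₂ → 1 < gcd (e₁ + n₁) e₁ ⊎ 1 < gcd (e₁ + n₁) e₂) e₂≡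
      (H (e₁ + n₁) (m≤m+n e₁ n₁) (+-monoʳ-≤ e₁ (m≤m+n n₁ n₂))))
  where
  e₂≡ : e₁ + (n₁ + n₂) ≡ e₁ + n₁ + n₂
  e₂≡ = sym (+-assoc e₁ n₁ n₂)

covered⇒partitionable : ∀ n e → 2 ≤ n →
  (∀ n₁ n₂ → 0 < n₁ → 0 < n₂ → n₁ + n₂ ≡ n → Covered e n₁ n₂) →
  PrimePartitionable n
covered⇒partitionable n@(suc v) e (s≤s 0<v) cover =
  colour e , trueWitness , falseWitness , partition
  where
  true-part : ∀ {p m} → Prime p → p ∣ e → p ∣ m → 0 < m → m < n → InPart n (colour e) true p
  true-part pp p∣e p∣m 0<m m<n = pp , ∣⇒<-bound p∣m 0<m m<n , dec-true (_ ∣? e) p∣e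

  false-part : ∀ {q m} → Prime q → ¬ (q ∣ e) → q ∣ m → 0 < m → m < n → InPart n (colour e) false q
  false-part qp q∤e q∣m 0<m m<n = qp , ∣⇒<-bound q∣m 0<m m<n , dec-false (_ ∣? e) q∤e

  trueWitness : ∃ λ p → InPart n (colour e) true p
  trueWitness with cover v 1 0<v z<s (+-comm v 1)
  ... | inj₁ (p , pp , p∣e , p∣v) = p , true-part pp p∣e p∣v 0<v ≤-refl
  ... | inj₂ (q , qp , _ , q∣1) = ⊥-elim (prime∤1 qp q∣1)

  falseWitness : ∃ λ q → InPart n (colour e) false q
  falseWitness with cover 1 v z<s 0<v refl
  ... | inj₁ (p , pp , _ , p∣1) = ⊥-elim (prime∤1 pp p∣1)
  ... | inj₂ (q , qp , q∤e , q∣v) = q , false-part qp q∤e q∣v 0<v ≤-refl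

  partition : ∀ n₁ n₂ → 0 < n₁ → 0 < n₂ → n₁ + n₂ ≡ n →
    ∃ λ p → ∃ λ q → InPart n (colour e) true p × InPart n (colour e) false q ×
      (1 < gcd n₁ p ⊎ 1 < gcd n₂ q)
  partition n₁ n₂ 0<n₁ 0<n₂ eq with cover n₁ n₂ 0<n₁ 0<n₂ eq
  ... | inj₁ (p , pp , p∣e , p∣n₁) =
    p , proj₁ falseWitness , true-part pp p∣e p∣n₁ 0<n₁ n₁<n , proj₂ falseWitness ,
    inj₁ (prime∣⇒gcd>1 pp p∣n₁)
    where
    n₁<n : n₁ < n
    n₁<n = subst (n₁ <_) eq (m<m+n n₁ 0<n₂)
  ... | inj₂ (q , qp , q∤e , q∣n₂) =
    proj₁ trueWitness , q , proj₂ trueWitness , false-part qp q∤e q∣n₂ 0<n₂ n₂<n ,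
    inj₂ (prime∣⇒gcd>1 qp q∣n₂)
    where
    n₂<n : n₂ < n
    n₂<n = subst (n₂ <_) eq (m<n+m n₂ 0<n₁)

lemma3 : ∀ (w : ℕ) → 2 ≤ w → ErdosWoods w → PrimePartitionable w
lemma3 w 2≤w (_ , e₁ , e₂ , _ , _ , refl , H) =
  covered⇒partitionable w e₁ 2≤w
    (λ n₁ n₂ _ _ → erdosWoods⇒covered e₁ H n₁ n₂)
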